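{- For all $\Gamma\cup\{A,B\}\subseteq\mathsf{Form}_\supset$: $\Gamma\cup\{A\}\vdash B$ iff $\Gamma\vdash A\supset B$, where $\vdash$ is derivability in $\mathbf{S}$.
   Context: Formulas $\mathsf{Form}_\supset$ are built from a countable set of propositional variables using binary connectives $\land,\lor,\to,\supset$. The proof system $\mathbf{S}$ has axiom schemata (for all formulas $A,B,C$) (Ax1) $A\to(B\to A)$; (Ax2) $(A\to(B\to C))\to((A\to B)\to(A\to C))$; (Ax3) $(A\land B)\to A$; (Ax4) $(A\land B)\to B$; (Ax5) $(C\to A)\to((C\to B)\to(C\to(A\land B)))$; (Ax6) $A\to(A\lor B)$; (Ax7) $B\to(A\lor B)$; (Ax8) $(A\to C)\to((B\to C)\to((A\lor B)\to C))$; (AxM1) $(A\to B)\supset(A\supset B)$; (AxM2) $(A\supset(B\supset C))\to((A\supset B)\supset(A\supset C))$; (AxM3) $(A\supset(B\to C))\to(B\to(A\supset C))$; (AxM4) $(A\to(B\supset C))\to(B\supset(A\to C))$; (AxM5) $((A\supset B)\supset C)\to((A\supset C)\to C)$; (AxM6) $(A\supset C)\to((B\supset C)\to((A\lor B)\supset C))$; and the single rule (MP): from $A$ and $A\supset B$ infer $B$. $\Gamma\vdash A$ iff there is a finite sequence ending in $A$ each member of which is in $\Gamma$, an axiom instance, or obtained by (MP) from earlier members. -}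

module Defs where

open import Data.Nat using (ℕ)
open import Data.Sum using (_⊎_)
open import Relation.Binary.PropositionalEquality using (_≡_)

infixr 6 _∧_
infixr 5 _∨_
infixr 4 _⇒_ _⊃_

data Form : Set where
  var : ℕ → Form
  _∧_ : Form → Form → Form
  _∨_ : Form → Form → Form
  _⇒_ : Form → Form → Form   -- the connective written → in the paper
  _⊃_ : Form → Form → Form

FSet : Set₁
FSet = Form → Set

_∪｛_｝ : FSet → Form → FSet
(Γ ∪｛ A ｝) C = Γ C ⊎ C ≡ A

data Axiom : Form → Set where
  ax1  : ∀ A B → Axiom (A ⇒ (B ⇒ A))
  ax2  : ∀ A B C → Axiom ((A ⇒ (B ⇒ C)) ⇒ ((A ⇒ B) ⇒ (A ⇒ C)))
  ax3  : ∀ A B → Axiom ((A ∧ B) ⇒ A)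
  ax4  : ∀ A B → Axiom ((A ∧ B) ⇒ B)
  ax5  : ∀ A B C → Axiom ((C ⇒ A) ⇒ ((C ⇒ B) ⇒ (C ⇒ (A ∧ B))))
  ax6  : ∀ A B → Axiom (A ⇒ (A ∨ B))
  ax7  : ∀ A B → Axiom (B ⇒ (A ∨ B))
  ax8  : ∀ A B C → Axiom ((A ⇒ C) ⇒ ((B ⇒ C) ⇒ ((A ∨ B) ⇒ C)))
  axM1 : ∀ A B → Axiom ((A ⇒ B) ⊃ (A ⊃ B))
  axM2 : ∀ A B C → Axiom ((A ⊃ (B ⊃ C)) ⇒ ((A ⊃ B) ⊃ (A ⊃ C)))
  axM3 : ∀ A B C → Axiom ((A ⊃ (B ⇒ C)) ⇒ (B ⇒ (A ⊃ C)))
  axM4 : ∀ A B C → Axiom ((A ⇒ (B ⊃ C)) ⇒ (B ⊃ (A ⇒ C)))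
  axM5 : ∀ A B C → Axiom (((A ⊃ B) ⊃ C) ⇒ ((A ⊃ C) ⇒ C))
  axM6 : ∀ A B C → Axiom ((A ⊃ C) ⇒ ((B ⊃ C) ⇒ ((A ∨ B) ⊃ C)))

-- Derivability Γ ⊢ A in S (derivation trees; equivalent to finite derivation sequences)
infix 3 _⊢_
data _⊢_ (Γ : FSet) : Form → Set where
  hyp : ∀ {A} → Γ A → Γ ⊢ A
  ax  : ∀ {A} → Axiom A → Γ ⊢ A
  mp  : ∀ {A B} → Γ ⊢ A → Γ ⊢ (A ⊃ B) → Γ ⊢ B

module Submission where

-- Modus ponens is stated for ⊃, so the deduction theorem is the usual induction on
-- derivations with ⊃ in the role of implication: AxM2 is its S-axiom, and the K and I
-- combinators for ⊃ are obtained from Ax1 and Ax2 for → by converting → into ⊃ with AxM1.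

open import Defs
open import Data.Product using (_×_; _,_)
open import Data.Sum using (inj₁; inj₂)
open import Relation.Binary.PropositionalEquality using (refl)
open import Relation.Unary using (_⊆_)

⇒-to-⊃ : ∀ {Γ A B} → Γ ⊢ (A ⇒ B) → Γ ⊢ (A ⊃ B)
⇒-to-⊃ {A = A} {B} f = mp f (ax (axM1 A B))

⇒-elim : ∀ {Γ A B} → Γ ⊢ A → Γ ⊢ (A ⇒ B) → Γ ⊢ B
⇒-elim a f = mp a (⇒-to-⊃ f)

⇒-refl : ∀ {Γ} A → Γ ⊢ (A ⇒ A)
⇒-refl A = ⇒-elim (ax (ax1 A A)) (⇒-elim (ax (ax1 A (A ⇒ A))) (ax (ax2 A (A ⇒ A) A)))

⊃-refl : ∀ {Γ} A → Γ ⊢ (A ⊃ A)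
⊃-refl A = ⇒-to-⊃ (⇒-refl A)

⊃-const : ∀ {Γ} A {B} → Γ ⊢ B → Γ ⊢ (A ⊃ B)
⊃-const A {B} b = ⇒-to-⊃ (⇒-elim b (ax (ax1 B A)))

⊃-mp : ∀ {Γ A B C} → Γ ⊢ (A ⊃ B) → Γ ⊢ (A ⊃ (B ⊃ C)) → Γ ⊢ (A ⊃ C)
⊃-mp {A = A} {B} {C} ab abc = mp ab (⇒-elim abc (ax (axM2 A B C)))

⊢-mono : ∀ {Γ Δ A} → Γ ⊆ Δ → Γ ⊢ A → Δ ⊢ A
⊢-mono Γ⊆Δ (hyp g)  = hyp (Γ⊆Δ g)
⊢-mono Γ⊆Δ (ax a)   = ax a
⊢-mono Γ⊆Δ (mp p q) = mp (⊢-mono Γ⊆Δ p) (⊢-mono Γ⊆Δ q)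

deduction : ∀ {Γ A B} → (Γ ∪｛ A ｝) ⊢ B → Γ ⊢ (A ⊃ B)
deduction {A = A} (hyp (inj₁ g))    = ⊃-const A (hyp g)
deduction {A = A} (hyp (inj₂ refl)) = ⊃-refl A
deduction {A = A} (ax a)            = ⊃-const A (ax a)
deduction (mp p q)                  = ⊃-mp (deduction p) (deduction q)

deduction⁻¹ : ∀ {Γ A B} → Γ ⊢ (A ⊃ B) → (Γ ∪｛ A ｝) ⊢ B
deduction⁻¹ p = mp (hyp (inj₂ refl)) (⊢-mono inj₁ p)

mainTheorem4 : (Γ : FSet) (A B : Form) →
    ((Γ ∪｛ A ｝) ⊢ B → Γ ⊢ (A ⊃ B)) × (Γ ⊢ (A ⊃ B) → (Γ ∪｛ A ｝) ⊢ B)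
mainTheorem4 Γ A B = deduction , deduction⁻¹
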